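{- Let $G$ be an oriented graph with $n$ vertices and $(1 - \epsilon)n^2/2$ edges. Then $G$ contains a vertex whose indegree and outdegree are both at least $(1-2\epsilon)n/4$.
   Context: An oriented graph is a digraph obtained from a simple undirected graph by orienting each of its edges (so there are no loops, no parallel edges and no pair of opposite edges). -}

module Defs where

open import Data.Nat using (ℕ)
open import Data.Nat.ListAction using (sum)
open import Data.Bool using (Bool; true; false)
open import Data.Fin using (Fin)
open import Data.List using (List; map)
open import Data.List using () renaming (allFin to allFinL)
open import Data.Integer using (+_)
open import Data.Rational using (ℚ; _/_)
open import Relation.Binary.PropositionalEquality using (_≡_)

-- An oriented graph on the vertex set Fin n, given by its arc relation
-- (adj i j ≡ true means there is an arc i → j).
-- No loops, and no pair of opposite arcs (parallel arcs are impossible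
-- since the arc relation is Boolean-valued).
record OrientedGraph (n : ℕ) : Set where
  field
    adj        : Fin n → Fin n → Bool
    irreflexive : ∀ i → adj i i ≡ false
    asymmetric  : ∀ i j → adj i j ≡ true → adj j i ≡ false

open OrientedGraph public

indicator : Bool → ℕ
indicator true  = 1
indicator false = 0

outdeg : ∀ {n} → OrientedGraph n → Fin n → ℕ
outdeg {n} G v = sum (map (λ w → indicator (adj G v w)) (allFinL n))

indeg : ∀ {n} → OrientedGraph n → Fin n → ℕ
indeg {n} G v = sum (map (λ w → indicator (adj G w v)) (allFinL n))

edgeCount : ∀ {n} → OrientedGraph n → ℕ
edgeCount {n} G = sum (map (outdeg G) (allFinL n))

toℚ : ℕ → ℚ
toℚ m = + m / 1

-- Let e be the number of arcs. Call a degree large if it is at least e/n − n/4, and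
-- charge each vertex its out-degree if its in-degree is large and its in-degree
-- otherwise. An arc u → w is paid for by u or by w unless u is charged its in-degree
-- and w its out-degree; for colour classes of sizes a + b = n there are at most
-- a b ≤ n²/4 such pairs. So the charges sum to at least e − n²/4 and some vertex has
-- a large charge; by the choice of its charge, both of its degrees are then large.
-- With e = (1 − ε)n²/2 the bound e/n − n/4 is (1 − 2ε)n/4.
module Submission where

module DegreeCounting where

  open import Defs
  import Algebra.Properties.Semiring.Sum
  open import Data.Bool using (Bool; true; false; not; if_then_else_)
  open import Data.Fin using (Fin; zero; suc)
  open import Data.Fin.Properties using (any?)
  open import Data.List using (map; tabulate)
  import Data.Nat.ListAction as List
  open import Data.Nat
  open import Data.Nat.Properties
  open import Data.Nat.Tactic.RingSolver using (solve-∀)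
  open import Data.Product using (∃; _×_; _,_)
  open import Data.Sum using (inj₁; inj₂)
  open import Function using (_∘_; id)
  open import Relation.Binary.PropositionalEquality
  open import Relation.Nullary using (Dec; yes; no; does; contradiction)

  open Algebra.Properties.Semiring.Sum +-*-semiring
    using (sum; sum-syntax; ∑-distrib-+; ∑-comm; sum-cong-≗; *-distribˡ-sum; *-distribʳ-sum)

  sum-map-tabulate : ∀ {m n} (f : Fin m → ℕ) (g : Fin n → Fin m) →
                     List.sum (map f (tabulate g)) ≡ ∑[ i < n ] f (g i)
  sum-map-tabulate {n = zero}  f g = refl
  sum-map-tabulate {n = suc n} f g = cong (f (g zero) +_) (sum-map-tabulate f (g ∘ suc))

  ∑-const : ∀ n c → ∑[ i < n ] c ≡ n * c
  ∑-const zero    c = refl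
  ∑-const (suc n) c = cong (c +_) (∑-const n c)

  ∑-*ˡ : ∀ {n} c (f : Fin n → ℕ) → ∑[ i < n ] (c * f i) ≡ c * sum f
  ∑-*ˡ c f = sym (*-distribˡ-sum c f)

  ∑-mono-≤ : ∀ {n} {f g : Fin n → ℕ} → (∀ i → f i ≤ g i) → sum f ≤ sum g
  ∑-mono-≤ {zero}  f≤g = z≤n
  ∑-mono-≤ {suc n} f≤g = +-mono-≤ (f≤g zero) (∑-mono-≤ (f≤g ∘ suc))

  ∑-mono-< : ∀ {n} .{{_ : NonZero n}} {f g : Fin n → ℕ} → (∀ i → f i < g i) → sum f < sum g
  ∑-mono-< {suc n} f<g = +-mono-<-≤ (f<g zero) (∑-mono-≤ (<⇒≤ ∘ f<g ∘ suc))

  *≤∑⇒∃≤ : ∀ {n} .{{_ : NonZero n}} t (f : Fin n → ℕ) →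
           n * t ≤ sum f → ∃ λ i → t ≤ f i
  *≤∑⇒∃≤ {n} t f n*t≤∑f with any? (λ i → t ≤? f i)
  ... | yes found = found
  ... | no  none  = contradiction n*t≤∑f (<⇒≱ (begin-strict
    sum f           <⟨ ∑-mono-< (λ i → ≰⇒> (λ t≤fi → none (i , t≤fi))) ⟩
    ∑[ i < n ] t    ≡⟨ ∑-const n t ⟩
    n * t           ∎))
    where open ≤-Reasoning

  ≤⇒4*m*n≤[m+n]² : ∀ {m n} → m ≤ n → 4 * (m * n) ≤ (m + n) * (m + n)
  ≤⇒4*m*n≤[m+n]² {m} m≤n with m≤n⇒∃[o]m+o≡n m≤n
  ... | k , refl = ≤-trans (m≤m+n _ (k * k)) (≤-reflexive (square-of-sum m k))
    where
    square-of-sum : ∀ m k → 4 * (m * (m + k)) + k * k ≡ (m + (m + k)) * (m + (m + k))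
    square-of-sum = solve-∀

  4*m*n≤[m+n]² : ∀ m n → 4 * (m * n) ≤ (m + n) * (m + n)
  4*m*n≤[m+n]² m n with ≤-total m n
  ... | inj₁ m≤n = ≤⇒4*m*n≤[m+n]² m≤n
  ... | inj₂ n≤m = subst₂ _≤_ (cong (4 *_) (*-comm n m)) (cong (λ s → s * s) (+-comm n m))
                          (≤⇒4*m*n≤[m+n]² n≤m)

  ∑-distrib-+₃ : ∀ {n} (f g h : Fin n → ℕ) →
                 ∑[ i < n ] (f i + g i + h i) ≡ sum f + sum g + sum h
  ∑-distrib-+₃ f g h = trans (∑-distrib-+ _ h) (cong (_+ sum h) (∑-distrib-+ f g))

  indicator-select : ∀ b x y → indicator b * x + indicator (not b) * y ≡ (if b then x else y)
  indicator-select true  x y = trans (+-identityʳ _) (*-identityˡ x)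
  indicator-select false x y = *-identityˡ y

  indicator+indicator-not : ∀ b → indicator b + indicator (not b) ≡ 1
  indicator+indicator-not true  = refl
  indicator+indicator-not false = refl

  arc-paid : ∀ a cu cw → indicator a ≤ indicator cu * indicator a + indicator (not cw) * indicator a
                                   + indicator (not cu) * indicator cw
  arc-paid false _     _     = z≤n
  arc-paid true  true  _     = s≤s z≤n
  arc-paid true  false true  = s≤s z≤n
  arc-paid true  false false = s≤s z≤n

  module Counting {n} (R : Fin n → Fin n → Bool) where

    inDegree outDegree : Fin n → ℕ
    inDegree  v = ∑[ u < n ] indicator (R u v)
    outDegree v = ∑[ w < n ] indicator (R v w)

    arcCount : ℕ
    arcCount = ∑[ v < n ] outDegree v

    -- d ≥ e/n − n/4 for the number e of arcs, with the denominators cleared.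
    LargeDegree : ℕ → Set
    LargeDegree d = 4 * arcCount ≤ n * n + 4 * n * d

    largeDegree? : ∀ d → Dec (LargeDegree d)
    largeDegree? d = 4 * arcCount ≤? n * n + 4 * n * d

    size : (Fin n → Bool) → ℕ
    size c = ∑[ v < n ] indicator (c v)

    size+size-not : ∀ c → size c + size (not ∘ c) ≡ n
    size+size-not c = begin
      size c + size (not ∘ c)
        ≡⟨ ∑-distrib-+ (indicator ∘ c) (indicator ∘ not ∘ c) ⟨
      ∑[ v < n ] (indicator (c v) + indicator (not (c v)))
        ≡⟨ sum-cong-≗ (indicator+indicator-not ∘ c) ⟩
      ∑[ v < n ] 1
        ≡⟨ ∑-const n 1 ⟩
      n * 1
        ≡⟨ *-identityʳ n ⟩
      n ∎
      where open ≡-Reasoning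

    charge : (Fin n → Bool) → Fin n → ℕ
    charge c v = if c v then outDegree v else inDegree v

    headPaid : (Fin n → Bool) → Fin n → Fin n → ℕ
    headPaid c u w = indicator (not (c w)) * indicator (R u w)

    outDegree≤ : ∀ c u → outDegree u ≤ indicator (c u) * outDegree u + ∑[ w < n ] headPaid c u w
                                       + indicator (not (c u)) * size c
    outDegree≤ c u = begin
      ∑[ w < n ] indicator (R u w)
        ≤⟨ ∑-mono-≤ (λ w → arc-paid (R u w) (c u) (c w)) ⟩
      ∑[ w < n ] (tailPaid w + headPaid c u w + crossing w)
        ≡⟨ ∑-distrib-+₃ tailPaid (headPaid c u) crossing ⟩
      sum tailPaid + ∑[ w < n ] headPaid c u w + sum crossing
        ≡⟨ cong₂ (λ x z → x + ∑[ w < n ] headPaid c u w + z)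
                 (∑-*ˡ (indicator (c u)) (indicator ∘ R u))
                 (∑-*ˡ (indicator (not (c u))) (indicator ∘ c)) ⟩
      indicator (c u) * outDegree u + ∑[ w < n ] headPaid c u w + indicator (not (c u)) * size c
        ∎
      where
      open ≤-Reasoning
      tailPaid crossing : Fin n → ℕ
      tailPaid w = indicator (c u) * indicator (R u w)
      crossing w = indicator (not (c u)) * indicator (c w)

    arcCount≤∑charge : ∀ c → arcCount ≤ ∑[ v < n ] charge c v + size (not ∘ c) * size c
    arcCount≤∑charge c = begin
      ∑[ u < n ] outDegree u
        ≤⟨ ∑-mono-≤ (outDegree≤ c) ⟩
      ∑[ u < n ] (tailCharge u + ∑[ w < n ] headPaid c u w + crossing u)
        ≡⟨ ∑-distrib-+₃ tailCharge (λ u → ∑[ w < n ] headPaid c u w) crossing ⟩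
      sum tailCharge + ∑[ u < n ] ∑[ w < n ] headPaid c u w + sum crossing
        ≡⟨ cong₂ (λ x z → sum tailCharge + x + z)
                 (trans (∑-comm (headPaid c))
                        (sum-cong-≗ (λ w → ∑-*ˡ (indicator (not (c w))) (λ u → indicator (R u w)))))
                 (sym (*-distribʳ-sum (size c) (indicator ∘ not ∘ c))) ⟩
      sum tailCharge + sum headCharge + size (not ∘ c) * size c
        ≡⟨ cong (_+ size (not ∘ c) * size c)
                (trans (sym (∑-distrib-+ tailCharge headCharge))
                       (sum-cong-≗ (λ v → indicator-select (c v) (outDegree v) (inDegree v)))) ⟩
      ∑[ v < n ] charge c v + size (not ∘ c) * size c
        ∎
      where
      open ≤-Reasoning
      tailCharge headCharge crossing : Fin n → ℕ
      tailCharge v = indicator (c v) * outDegree v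
      headCharge v = indicator (not (c v)) * inDegree v
      crossing   v = indicator (not (c v)) * size c

    n*4e≤∑[n²+4n*charge] : ∀ c → n * (4 * arcCount) ≤ ∑[ v < n ] (n * n + 4 * n * charge c v)
    n*4e≤∑[n²+4n*charge] c = begin
      n * (4 * arcCount)
        ≡⟨ *-assoc n 4 arcCount ⟨
      n * 4 * arcCount
        ≤⟨ *-monoʳ-≤ (n * 4) (arcCount≤∑charge c) ⟩
      n * 4 * (sum (charge c) + size (not ∘ c) * size c)
        ≡⟨ regroup n (sum (charge c)) (size (not ∘ c) * size c) ⟩
      n * (4 * (size (not ∘ c) * size c)) + 4 * n * sum (charge c)
        ≤⟨ +-monoˡ-≤ _ (*-monoʳ-≤ n crossing≤n²/4) ⟩
      n * (n * n) + 4 * n * sum (charge c)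
        ≡⟨ cong₂ _+_ (∑-const n (n * n)) (∑-*ˡ (4 * n) (charge c)) ⟨
      ∑[ v < n ] (n * n) + ∑[ v < n ] (4 * n * charge c v)
        ≡⟨ ∑-distrib-+ (λ _ → n * n) (λ v → 4 * n * charge c v) ⟨
      ∑[ v < n ] (n * n + 4 * n * charge c v)
        ∎
      where
      open ≤-Reasoning
      regroup : ∀ n x y → n * 4 * (x + y) ≡ n * (4 * y) + 4 * n * x
      regroup = solve-∀
      crossing≤n²/4 : 4 * (size (not ∘ c) * size c) ≤ n * n
      crossing≤n²/4 = subst (λ m → 4 * (size (not ∘ c) * size c) ≤ m * m)
                            (trans (+-comm (size (not ∘ c)) (size c)) (size+size-not c))
                            (4*m*n≤[m+n]² (size (not ∘ c)) (size c))

    largeIn : Fin n → Bool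
    largeIn v = does (largeDegree? (inDegree v))

    large-in-and-out-degree : .{{_ : NonZero n}} →
                              ∃ λ v → LargeDegree (inDegree v) × LargeDegree (outDegree v)
    large-in-and-out-degree =
      let v , chargeLarge = *≤∑⇒∃≤ (4 * arcCount) (λ v → n * n + 4 * n * charge largeIn v)
                                    (n*4e≤∑[n²+4n*charge] largeIn)
      in  v , both-large v (largeDegree? (inDegree v)) chargeLarge
      where
      both-large : ∀ v (d : Dec (LargeDegree (inDegree v))) →
                   LargeDegree (if does d then outDegree v else inDegree v) →
                   LargeDegree (inDegree v) × LargeDegree (outDegree v)
      both-large v (yes inLarge) outLarge = inLarge , outLarge
      both-large v (no  inSmall) inLarge  = contradiction inLarge inSmall

  module _ {n} (G : OrientedGraph n) where
    open Counting (adj G)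

    indeg≡inDegree : ∀ v → indeg G v ≡ inDegree v
    indeg≡inDegree v = sum-map-tabulate (λ u → indicator (adj G u v)) id

    outdeg≡outDegree : ∀ v → outdeg G v ≡ outDegree v
    outdeg≡outDegree v = sum-map-tabulate (indicator ∘ adj G v) id

    edgeCount≡arcCount : edgeCount G ≡ arcCount
    edgeCount≡arcCount = trans (sum-map-tabulate (outdeg G) id) (sum-cong-≗ outdeg≡outDegree)

    graph-large-in-and-out-degree : .{{_ : NonZero n}} →
      ∃ λ v → 4 * edgeCount G ≤ n * n + 4 * n * indeg G v
            × 4 * edgeCount G ≤ n * n + 4 * n * outdeg G v
    graph-large-in-and-out-degree =
      let v , inLarge , outLarge = large-in-and-out-degree
      in  v , subst₂ LargeDegree′ (sym edgeCount≡arcCount) (sym (indeg≡inDegree v)) inLarge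
            , subst₂ LargeDegree′ (sym edgeCount≡arcCount) (sym (outdeg≡outDegree v)) outLarge
      where
      LargeDegree′ : ℕ → ℕ → Set
      LargeDegree′ e d = 4 * e ≤ n * n + 4 * n * d


open import Defs
open import Data.Fin using (Fin)
open import Data.Integer as ℤ using (+_)
import Data.Integer.Properties as ℤ
open import Data.Nat as ℕ using (ℕ; _≥_; NonZero)
open import Data.Nat.Coprimality using (1-coprimeTo) renaming (sym to coprime-sym)
open import Data.Nat.Properties using (m*n≢0)
open import Data.Product using (∃; _×_; _,_)
open import Data.Rational using (ℚ; mkℚ; toℚᵘ; Positive; _≤_; _+_; _*_; _-_; -_; 1ℚ; ½)
open import Data.Rational.Properties
  using (normalize-coprime; toℚᵘ-injective; toℚᵘ-homo-+; toℚᵘ-homo-*; toℚᵘ-cancel-≤;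
         *-cancelˡ-≤-pos; +-monoˡ-≤; module ≤-Reasoning)
open import Data.Rational.Solver using (module +-*-Solver)
import Data.Rational.Unnormalised as ℚᵘ
import Data.Rational.Unnormalised.Properties as ℚᵘ
open import Relation.Binary.PropositionalEquality

open DegreeCounting using (graph-large-in-and-out-degree)

toℚ≡mkℚ : ∀ m → toℚ m ≡ mkℚ (+ m) 0 (coprime-sym (1-coprimeTo m))
toℚ≡mkℚ m = normalize-coprime (coprime-sym (1-coprimeTo m))

toℚᵘ-toℚ : ∀ m → toℚᵘ (toℚ m) ≡ ℚᵘ.mkℚᵘ (+ m) 0
toℚᵘ-toℚ m = cong toℚᵘ (toℚ≡mkℚ m)

toℚ-homo-+ : ∀ a b → toℚ (a ℕ.+ b) ≡ toℚ a + toℚ b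
toℚ-homo-+ a b = toℚᵘ-injective (begin
  toℚᵘ (toℚ (a ℕ.+ b))                  ≡⟨ toℚᵘ-toℚ (a ℕ.+ b) ⟩
  ℚᵘ.mkℚᵘ (+ (a ℕ.+ b)) 0               ≈⟨ ℚᵘ.*≡* (cong (ℤ._* + 1) numerator) ⟩
  ℚᵘ.mkℚᵘ (+ a) 0 ℚᵘ.+ ℚᵘ.mkℚᵘ (+ b) 0  ≡⟨ cong₂ ℚᵘ._+_ (toℚᵘ-toℚ a) (toℚᵘ-toℚ b) ⟨
  toℚᵘ (toℚ a) ℚᵘ.+ toℚᵘ (toℚ b)        ≈⟨ toℚᵘ-homo-+ (toℚ a) (toℚ b) ⟨
  toℚᵘ (toℚ a + toℚ b)                  ∎)
  where
  open ℚᵘ.≃-Reasoning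
  numerator : + (a ℕ.+ b) ≡ + a ℤ.* + 1 ℤ.+ + b ℤ.* + 1
  numerator = trans (ℤ.pos-+ a b) (sym (cong₂ ℤ._+_ (ℤ.*-identityʳ (+ a)) (ℤ.*-identityʳ (+ b))))

toℚ-homo-* : ∀ a b → toℚ (a ℕ.* b) ≡ toℚ a * toℚ b
toℚ-homo-* a b = toℚᵘ-injective (begin
  toℚᵘ (toℚ (a ℕ.* b))                  ≡⟨ toℚᵘ-toℚ (a ℕ.* b) ⟩
  ℚᵘ.mkℚᵘ (+ (a ℕ.* b)) 0               ≈⟨ ℚᵘ.*≡* (cong (ℤ._* + 1) (ℤ.pos-* a b)) ⟩
  ℚᵘ.mkℚᵘ (+ a) 0 ℚᵘ.* ℚᵘ.mkℚᵘ (+ b) 0  ≡⟨ cong₂ ℚᵘ._*_ (toℚᵘ-toℚ a) (toℚᵘ-toℚ b) ⟨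
  toℚᵘ (toℚ a) ℚᵘ.* toℚᵘ (toℚ b)        ≈⟨ toℚᵘ-homo-* (toℚ a) (toℚ b) ⟨
  toℚᵘ (toℚ a * toℚ b)                  ∎)
  where open ℚᵘ.≃-Reasoning

toℚ-mono-≤ : ∀ {a b} → a ℕ.≤ b → toℚ a ≤ toℚ b
toℚ-mono-≤ {a} {b} a≤b = toℚᵘ-cancel-≤ (subst₂ ℚᵘ._≤_ (sym (toℚᵘ-toℚ a)) (sym (toℚᵘ-toℚ b))
  (ℚᵘ.*≤* (ℤ.*-monoʳ-≤-nonNeg (+ 1) (ℤ.+≤+ a≤b))))

toℚ-positive : ∀ m .{{_ : NonZero m}} → Positive (toℚ m)
toℚ-positive (ℕ.suc m) = subst Positive (sym (toℚ≡mkℚ (ℕ.suc m))) _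

large-degree-bound : ∀ n .{{_ : NonZero n}} e d ε →
                     toℚ e ≡ (1ℚ - ε) * toℚ n * toℚ n * ½ →
                     4 ℕ.* e ℕ.≤ n ℕ.* n ℕ.+ 4 ℕ.* n ℕ.* d →
                     (1ℚ - toℚ 2 * ε) * toℚ n * ½ * ½ ≤ toℚ d
large-degree-bound n e d ε edges 4e≤n²+4nd = *-cancelˡ-≤-pos (toℚ 4 * N) {{4N-positive}} (begin
  toℚ 4 * N * ((1ℚ - toℚ 2 * ε) * N * ½ * ½)  ≡⟨ bound-identity ε N ⟩
  toℚ 4 * ((1ℚ - ε) * N * N * ½) - N * N      ≡⟨ cong (λ x → toℚ 4 * x - N * N) edges ⟨
  toℚ 4 * E - N * N                           ≤⟨ +-monoˡ-≤ (- (N * N)) 4E≤N²+4ND ⟩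
  N * N + toℚ 4 * N * D - N * N               ≡⟨ cancel-square N D ⟩
  toℚ 4 * N * D                               ∎)
  where
  open ≤-Reasoning
  open +-*-Solver
  N = toℚ n
  D = toℚ d
  E = toℚ e
  4N-positive : Positive (toℚ 4 * N)
  4N-positive = subst Positive (toℚ-homo-* 4 n) (toℚ-positive (4 ℕ.* n) {{m*n≢0 4 n}})
  4E≤N²+4ND : toℚ 4 * E ≤ N * N + toℚ 4 * N * D
  4E≤N²+4ND = subst₂ _≤_ (toℚ-homo-* 4 e)
    (trans (toℚ-homo-+ (n ℕ.* n) (4 ℕ.* n ℕ.* d))
           (cong₂ _+_ (toℚ-homo-* n n)
                      (trans (toℚ-homo-* (4 ℕ.* n) d) (cong (_* D) (toℚ-homo-* 4 n)))))
    (toℚ-mono-≤ 4e≤n²+4nd)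
  bound-identity : ∀ ε N → toℚ 4 * N * ((1ℚ - toℚ 2 * ε) * N * ½ * ½)
                          ≡ toℚ 4 * ((1ℚ - ε) * N * N * ½) - N * N
  bound-identity = solve 2 (λ ε N →
    con (toℚ 4) :* N :* ((con 1ℚ :- con (toℚ 2) :* ε) :* N :* con ½ :* con ½)
      := con (toℚ 4) :* ((con 1ℚ :- ε) :* N :* N :* con ½) :- N :* N) refl
  cancel-square : ∀ N D → N * N + toℚ 4 * N * D - N * N ≡ toℚ 4 * N * D
  cancel-square = solve 2 (λ N D →
    N :* N :+ con (toℚ 4) :* N :* D :- N :* N := con (toℚ 4) :* N :* D) refl

lemma2p1 : (n : ℕ) → n ≥ 1 → (G : OrientedGraph n) → (ε : ℚ)
    → toℚ (edgeCount G) ≡ (1ℚ - ε) * toℚ n * toℚ n * ½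
    → ∃ λ (v : Fin n)
        → ((1ℚ - toℚ 2 * ε) * toℚ n * ½ * ½ ≤ toℚ (indeg G v))
        × ((1ℚ - toℚ 2 * ε) * toℚ n * ½ * ½ ≤ toℚ (outdeg G v))
lemma2p1 n n≥1 G ε edges =
  let v , inLarge , outLarge = graph-large-in-and-out-degree G
  in  v , large-degree-bound n (edgeCount G) (indeg G v) ε edges inLarge
        , large-degree-bound n (edgeCount G) (outdeg G v) ε edges outLarge
  where instance _ = ℕ.>-nonZero n≥1
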